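{- Let $d \ge 1$ and $1 \le r \le d$ be integers. There exists a $d$-regular generalized graph $G$ on $d + r$ vertices which has no loops and no multiple edges and has an independent exact $r$-cover, with the following additional property: if $d$ is even, then $G$ is simple (has no semi-edges); if $d$ is odd, then $G$ has a 1-factor $M$ such that every semi-edge of $G$ is in $M$.
   Context: A generalized graph consists of a set $V$ of vertices and a set $D$ of darts; each dart is incident to exactly one vertex, and the darts are partitioned into pairs and singletons. Two paired darts incident to distinct vertices form an ordinary edge; two distinct paired darts at the same vertex form a loop; an unpaired dart is a semi-edge. The degree of a vertex is the number of darts incident to it (loop counts 2, semi-edge 1). A 1-factor is a set of edges (ordinary edges and semi-edges) such that every vertex is incident to exactly one dart in it. A vertex subset $S$ is independent if no vertex of $S$ is incident to a loop or a semi-edge and there is no ordinary edge between two vertices of $S$; $S$ is an exact $r$-cover if every vertex outside $S$ is incident to exactly $r$ ordinary edges with other endpoint in $S$ (counted with multiplicity). An independent exact $r$-cover is a set that is both. -}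

module Defs where

open import Data.Nat using (ℕ)
import Agda.Primitive
open import Data.Fin using (Fin; _≟_)
open import Data.Fin.Subset using (Subset; _∈_; _∉_)
open import Data.Fin.Subset.Properties using (_∈?_)
open import Data.List using (List; length; filter; allFin)
open import Data.Bool using (Bool; true)
open import Data.Product using (_×_)
open import Relation.Nullary using (¬_)
open import Relation.Nullary.Decidable using (_×-dec_; ¬?)
open import Relation.Unary using (Pred; Decidable)
open import Relation.Binary.PropositionalEquality using (_≡_; _≢_)

count : ∀ {n} {P : Pred (Fin n) Agda.Primitive.lzero} → Decidable P → ℕ
count {n} P? = length (filter P? (allFin n))

-- A finite generalized graph: vertices Fin nV, darts Fin nD,
-- each dart incident to the vertex  vert x ; the partition of darts into
-- pairs and singletons is given by an involution  pair  on darts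
-- (fixed points = unpaired darts = semi-edges).
record GenGraph : Set where
  field
    nV : ℕ
    nD : ℕ
    vert : Fin nD → Fin nV
    pair : Fin nD → Fin nD
    pair-invol : ∀ x → pair (pair x) ≡ x

module _ (G : GenGraph) where
  open GenGraph G

  IsSemi : Fin nD → Set
  IsSemi x = pair x ≡ x

  IsLoop : Fin nD → Set
  IsLoop x = pair x ≢ x × vert (pair x) ≡ vert x

  IsOrdinary : Fin nD → Set
  IsOrdinary x = pair x ≢ x × vert (pair x) ≢ vert x

  degree : Fin nV → ℕ
  degree v = count (λ x → vert x ≟ v)

  Regular : ℕ → Set
  Regular d = ∀ v → degree v ≡ d

  NoLoops : Set
  NoLoops = ∀ x → ¬ IsLoop x

  NoSemiEdges : Set
  NoSemiEdges = ∀ x → ¬ IsSemi x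

  -- no two distinct ordinary edges have the same pair of endpoints
  -- (edge {x , pair x} equals edge {y , pair y} iff y ≡ x or y ≡ pair x;
  --  we compare darts at the same endpoint, so y ≡ x is the conclusion)
  NoMultipleEdges : Set
  NoMultipleEdges = ∀ x y → IsOrdinary x → IsOrdinary y →
    vert x ≡ vert y → vert (pair x) ≡ vert (pair y) → x ≡ y

  Simple : Set
  Simple = NoLoops × NoMultipleEdges × NoSemiEdges

  -- a set of edges, given as the set of its darts (closed under pair);
  -- it is a 1-factor if every vertex is incident to exactly one of its darts
  IsOneFactor : (Fin nD → Bool) → Set
  IsOneFactor M = (∀ x → M (pair x) ≡ M x)
    × (∀ v → count (λ x → (vert x ≟ v) ×-dec (M x Data.Bool.≟ true)) ≡ 1)

  Independent : Subset nV → Set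
  Independent S = (∀ x → vert x ∈ S → ¬ IsLoop x)
    × (∀ x → vert x ∈ S → ¬ IsSemi x)
    × (∀ x → IsOrdinary x → vert x ∈ S → vert (pair x) ∉ S)

  edgesInto : Subset nV → Fin nV → ℕ
  edgesInto S v = count (λ x → (vert x ≟ v)
                          ×-dec (¬? (pair x ≟ x)
                          ×-dec (¬? (vert (pair x) ≟ vert x)
                          ×-dec (vert (pair x) ∈? S))))

  ExactCover : ℕ → Subset nV → Set
  ExactCover r S = ∀ v → v ∉ S → edgesInto S v ≡ r

  IndependentExactCover : ℕ → Subset nV → Set
  IndependentExactCover r S = Independent S × ExactCover r S

-- Split the d + r vertices into A = Fin d and the cover S = Fin r, join every vertex of A
-- to every vertex of S, and fill up the degrees in A with the last m = d - r colour classes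
-- of a 1-factorisation of a generalized graph on A.  For odd d the classes are
-- {i, j : i + j ≡ k (mod d)}, k < d, each leaving only k/2 unmatched, which gets a
-- semi-edge.  For even d one vertex ∞ is added to Fin (d - 1) and matched with k/2, the
-- classical 1-factorisation of K_d, so no semi-edges remain.
-- For odd d, at each a ∈ A take the slot 2a (mod d): slot t < r leads to cover vertex t,
-- slot t ≥ r carries colour t, and a is fixed by colour t exactly when t = 2a.  So this
-- picks the semi-edge of a if it has one and an edge to S otherwise, and since doubling
-- is a bijection for odd d every cover vertex is picked exactly once: a 1-factor.

module Submission where

open import Defs
open import Data.Nat using (ℕ; _+_; _≤_)
open import Data.Nat.Divisibility using (_∣_)
open import Data.Fin using (Fin)
open import Data.Fin.Subset using (Subset)
open import Data.Bool using (Bool; true)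
open import Data.Product using (Σ; _×_)
open import Relation.Nullary using (¬_)
open import Relation.Binary.PropositionalEquality using (_≡_)

open import Data.Nat using (zero; suc; _*_; _∸_; _<_; _≤?_; _<?_; s<s; s<s⁻¹)
open import Data.Nat.Properties
  using ( +-suc; +-comm; +-assoc; +-identityʳ; *-comm; +-cancelˡ-≡; +-cancelʳ-≡; +-cancelˡ-<; +-cancelʳ-<
        ; +-mono-≤; +-mono-<; +-monoˡ-<; ≤-antisym; ≤-reflexive; ≤-trans; ≤-<-trans; <⇒≤; <⇒≱; ≤⇒≯; ≮⇒≥; ≰⇒>
        ; m≤m+n; m≤n+m; m∸n≤m; m∸n+n≡m; m+[n∸m]≡n; m≤n⇒∃[o]m+o≡n )
open import Data.Nat.Divisibility using (divides; ∣m+n∣m⇒∣n; ∣1⇒≡1; _∣?_)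
open import Data.Nat.Tactic.RingSolver using (solve-∀)
open import Data.Fin using (zero; suc; toℕ; fromℕ<; _≟_; _↑ˡ_; _↑ʳ_; splitAt; combine; remQuot)
open import Data.Fin.Properties
  using ( suc-injective; 0≢1+n; toℕ-injective; toℕ<n; toℕ-fromℕ<; ↑ˡ-injective; ↑ʳ-injective
        ; splitAt-↑ˡ; splitAt-↑ʳ; combine-remQuot; remQuot-combine; combine-surjective )
open import Data.Fin.Permutation using (Permutation′; permutation; _⟨$⟩ʳ_; _⟨$⟩ˡ_; inverseˡ; inverseʳ)
open import Data.Fin.Subset using (_∈_; _∉_; ⊥; ⊤)
open import Data.Fin.Subset.Properties using (_∈?_; ∉⊥; ∈⊤)
open import Data.Vec using (_++_)
open import Data.Vec.Properties using (lookup-++ˡ; lookup-++ʳ; []=⇒lookup; lookup⇒[]=)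
open import Data.List using (List; []; _∷_; length; filter; map; tabulate; allFin)
open import Data.List.Properties
  using (filter-accept; filter-reject; filter-all; filter-none; filter-≐; map-tabulate; length-tabulate)
open import Data.List.Relation.Unary.All.Properties using (tabulate⁺)
open import Data.Bool using (false)
import Data.Bool
open import Data.Empty using (⊥-elim)
open import Data.Product using (∃; ∃₂; _,_; proj₁; proj₂; uncurry)
open import Data.Sum using (_⊎_; inj₁; inj₂; [_,_]′)
open import Function using (_∘_; id)
open import Function.Bundles using (_⇔_; mk⇔; Equivalence)
open import Level using (0ℓ)
open import Relation.Nullary using (Dec; does; yes; no; contradiction)
open import Relation.Nullary.Decidable using (_×-dec_; dec-true; does-⇔)
open import Relation.Unary using (Pred; Decidable; _≐_)
open import Relation.Binary.PropositionalEquality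
  using (_≢_; refl; sym; trans; cong; cong₂; subst; subst₂; module ≡-Reasoning)

length-filter-map : ∀ {A B : Set} {P : Pred B 0ℓ} (P? : Decidable P) (f : A → B) (xs : List A) →
                    length (filter P? (map f xs)) ≡ length (filter (P? ∘ f) xs)
length-filter-map P? f []       = refl
length-filter-map P? f (x ∷ xs) with does (P? (f x))
... | true  = cong suc (length-filter-map P? f xs)
... | false = length-filter-map P? f xs

module _ {n} {P : Pred (Fin (suc n)) 0ℓ} (P? : Decidable P) where

  private
    count-tail : length (filter P? (tabulate suc)) ≡ count (P? ∘ suc)
    count-tail = trans (cong (length ∘ filter P?) (sym (map-tabulate id suc)))
                       (length-filter-map P? suc (allFin n))

  count-accept : P zero → count P? ≡ suc (count (P? ∘ suc))
  count-accept p = trans (cong length (filter-accept P? p)) (cong suc count-tail)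

  count-reject : ¬ P zero → count P? ≡ count (P? ∘ suc)
  count-reject ¬p = trans (cong length (filter-reject P? ¬p)) count-tail

module _ {n} {P Q : Pred (Fin n) 0ℓ} where

  count-≐ : (P? : Decidable P) (Q? : Decidable Q) → P ≐ Q → count P? ≡ count Q?
  count-≐ P? Q? P≐Q = cong length (filter-≐ P? Q? P≐Q (allFin n))

module _ {n} {P : Pred (Fin n) 0ℓ} (P? : Decidable P) where

  count-all : (∀ i → P i) → count P? ≡ n
  count-all all = trans (cong length (filter-all P? (tabulate⁺ all))) (length-tabulate id)

  count-none : (∀ i → ¬ P i) → count P? ≡ 0
  count-none none = cong length (filter-none P? (tabulate⁺ none))

count-unique : ∀ {n} {P : Pred (Fin n) 0ℓ} (P? : Decidable P) {a} →
               P a → (∀ i → P i → i ≡ a) → count P? ≡ 1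
count-unique P? {zero}  pa unique =
  trans (count-accept P? pa)
        (cong suc (count-none (P? ∘ suc) λ i p → 0≢1+n (sym (unique (suc i) p))))
count-unique P? {suc a} pa unique =
  trans (count-reject P? λ p → 0≢1+n (unique zero p))
        (count-unique (P? ∘ suc) pa λ i p → suc-injective (unique (suc i) p))

count-+ : ∀ m {n} {P : Pred (Fin (m + n)) 0ℓ} (P? : Decidable P) →
          count P? ≡ count (P? ∘ (_↑ˡ n)) + count (P? ∘ (m ↑ʳ_))
count-+ zero    P? = refl
count-+ (suc m) {n} {P} P? = by-cases (P? zero)
  where
    open ≡-Reasoning
    right = count (P? ∘ (suc m ↑ʳ_))
    by-cases : Dec (P zero) → count P? ≡ count (P? ∘ (_↑ˡ n)) + right
    by-cases (yes p) = begin
      count P?                                  ≡⟨ count-accept P? p ⟩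
      suc (count (P? ∘ suc))                    ≡⟨ cong suc (count-+ m (P? ∘ suc)) ⟩
      suc (count (P? ∘ suc ∘ (_↑ˡ n)) + right)  ≡⟨ cong (_+ right) (count-accept (P? ∘ (_↑ˡ n)) p) ⟨
      count (P? ∘ (_↑ˡ n)) + right              ∎
    by-cases (no ¬p) = begin
      count P?                                  ≡⟨ count-reject P? ¬p ⟩
      count (P? ∘ suc)                          ≡⟨ count-+ m (P? ∘ suc) ⟩
      count (P? ∘ suc ∘ (_↑ˡ n)) + right        ≡⟨ cong (_+ right) (count-reject (P? ∘ (_↑ˡ n)) ¬p) ⟨
      count (P? ∘ (_↑ˡ n)) + right              ∎

count-combine : ∀ {n k} {P : Pred (Fin (n * k)) 0ℓ} (P? : Decidable P) (v : Fin n) →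
                (∀ u t → P (combine u t) → u ≡ v) → count P? ≡ count (λ t → P? (combine v t))
count-combine {suc n} {k} {P} P? zero only = begin
  count P?                            ≡⟨ count-+ k P? ⟩
  count first + count (P? ∘ (k ↑ʳ_))  ≡⟨ cong (count first +_) (count-none _ elsewhere) ⟩
  count first + 0                     ≡⟨ +-identityʳ _ ⟩
  count first                         ∎
  where
    open ≡-Reasoning
    first = λ t → P? (combine {suc n} zero t)
    elsewhere : ∀ x → ¬ P (k ↑ʳ x)
    elsewhere x p with u , t , refl ← combine-surjective {n} x = 0≢1+n (sym (only (suc u) t p))
count-combine {suc n} {k} {P} P? (suc v) only = begin
  count P?                            ≡⟨ count-+ k P? ⟩
  count first + count rest            ≡⟨ cong (_+ count rest) (count-none _ λ t p → 0≢1+n (only zero t p)) ⟩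
  count rest                          ≡⟨ count-combine rest v (λ u t p → suc-injective (only (suc u) t p)) ⟩
  count (λ t → P? (combine (suc v) t)) ∎
  where
    open ≡-Reasoning
    first = λ t → P? (combine {suc n} zero t)
    rest  = P? ∘ (k ↑ʳ_)

module _ (G : GenGraph) where
  open GenGraph G

  outward⇒independent : ∀ {S} → (∀ x → vert x ∈ S → vert (pair x) ∉ S) → Independent G S
  outward⇒independent {S} outward =
      (λ x x∈S (_ , loop) → outward x x∈S (subst (_∈ S) (sym loop) x∈S))
    , (λ x x∈S semi → outward x x∈S (subst (λ y → vert y ∈ S) (sym semi) x∈S))
    , (λ x _ → outward x)

  edgesInto-∉ : ∀ {S v} → v ∉ S →
                edgesInto G S v ≡ count (λ x → (vert x ≟ v) ×-dec (vert (pair x) ∈? S))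
  edgesInto-∉ {S} {v} v∉S = count-≐ {nD} _ _
    ( (λ (at , _ , _ , into) → at , into)
    , λ (at , into) → at
                    , (λ semi → v∉S (subst (_∈ S) (trans (cong vert semi) at) into))
                    , (λ loop → v∉S (subst (_∈ S) (trans loop at) into))
                    , into )

module SlotGraph {n d : ℕ} (link : Fin n × Fin d → Fin n × Fin d)
                 (link-involutive : ∀ p → link (link p) ≡ p) where

  dart : Fin n × Fin d → Fin (n * d)
  dart = uncurry combine

  private
    remQuot-dart : ∀ p → remQuot d (dart p) ≡ p
    remQuot-dart (v , t) = remQuot-combine v t

    dart-remQuot : ∀ x → dart (remQuot d x) ≡ x
    dart-remQuot = combine-remQuot {n} d

  graph : GenGraph
  graph = record
    { nV = n
    ; nD = n * d
    ; vert = proj₁ ∘ remQuot d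
    ; pair = dart ∘ link ∘ remQuot d
    ; pair-invol = λ x → begin
        dart (link (remQuot d (dart (link (remQuot d x))))) ≡⟨ cong (dart ∘ link) (remQuot-dart _) ⟩
        dart (link (link (remQuot d x)))                    ≡⟨ cong dart (link-involutive _) ⟩
        dart (remQuot d x)                                  ≡⟨ dart-remQuot x ⟩
        x                                                   ∎
    }
    where open ≡-Reasoning

  open GenGraph graph using (vert; pair)

  vert-dart : ∀ p → vert (dart p) ≡ proj₁ p
  vert-dart p = cong proj₁ (remQuot-dart p)

  pair-dart : ∀ p → pair (dart p) ≡ dart (link p)
  pair-dart p = cong (dart ∘ link) (remQuot-dart p)

  dart-injective : ∀ {p q} → dart p ≡ dart q → p ≡ q
  dart-injective {p} {q} eq = trans (sym (remQuot-dart p)) (trans (cong (remQuot d) eq) (remQuot-dart q))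

  ∀-dart : ∀ {P : Fin (n * d) → Set} → (∀ p → P (dart p)) → ∀ x → P x
  ∀-dart {P} P-dart x = subst P (dart-remQuot x) (P-dart (remQuot d x))

  count-at : ∀ {P : Pred (Fin (n * d)) 0ℓ} (P? : Decidable P) v →
             (∀ x → P x → vert x ≡ v) → count P? ≡ count (λ t → P? (dart (v , t)))
  count-at P? v only = count-combine P? v λ u t p → trans (sym (vert-dart (u , t))) (only _ p)

  regular : Regular graph d
  regular v = trans (count-at _ v λ _ at → at) (count-all _ λ t → vert-dart (v , t))

  vert-pair-dart : ∀ p → vert (pair (dart p)) ≡ proj₁ (link p)
  vert-pair-dart p = trans (cong vert (pair-dart p)) (vert-dart (link p))

  noLoops : (∀ p → proj₁ (link p) ≡ proj₁ p → link p ≡ p) → NoLoops graph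
  noLoops stays = ∀-dart λ p (moves , loop) → moves (begin
    pair (dart p)  ≡⟨ pair-dart p ⟩
    dart (link p)  ≡⟨ cong dart (stays p (trans (sym (vert-pair-dart p)) (trans loop (vert-dart p)))) ⟩
    dart p         ∎)
    where open ≡-Reasoning

  noMultipleEdges : (∀ v {t t′} → proj₁ (link (v , t)) ≡ proj₁ (link (v , t′)) → t ≡ t′) →
                    NoMultipleEdges graph
  noMultipleEdges link-injective = ∀-dart λ p → ∀-dart λ q _ _ → same-ends p q
    where
      same-ends : ∀ p q → vert (dart p) ≡ vert (dart q) →
                  vert (pair (dart p)) ≡ vert (pair (dart q)) → dart p ≡ dart q
      same-ends (v , t) (v′ , t′) same-v same-w
        with trans (sym (vert-dart (v , t))) (trans same-v (vert-dart (v′ , t′)))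
      ... | refl = cong (dart ∘ (v ,_)) (link-injective v
                     (trans (sym (vert-pair-dart (v , t))) (trans same-w (vert-pair-dart (v , t′)))))

  noSemiEdges : (∀ p → link p ≢ p) → NoSemiEdges graph
  noSemiEdges moves = ∀-dart λ p semi → moves p (dart-injective (trans (sym (pair-dart p)) semi))

  outward : ∀ {S} → (∀ p → proj₁ p ∈ S → proj₁ (link p) ∉ S) → ∀ x → vert x ∈ S → vert (pair x) ∉ S
  outward {S} out = ∀-dart λ p p∈S →
    subst (_∉ S) (sym (vert-pair-dart p)) (out p (subst (_∈ S) (vert-dart p) p∈S))

  edgesInto-slots : ∀ {S v} → v ∉ S → edgesInto graph S v ≡ count (λ t → proj₁ (link (v , t)) ∈? S)
  edgesInto-slots {S} {v} v∉S = begin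
    edgesInto graph S v                                          ≡⟨ edgesInto-∉ graph v∉S ⟩
    count (λ x → (vert x ≟ v) ×-dec (vert (pair x) ∈? S))        ≡⟨ count-at _ v (λ _ → proj₁) ⟩
    count (λ t → (vert (dart (v , t)) ≟ v) ×-dec (vert (pair (dart (v , t))) ∈? S))
                                                                 ≡⟨ count-≐ {d} _ _ (to , from) ⟩
    count (λ t → proj₁ (link (v , t)) ∈? S)                     ∎
    where
      open ≡-Reasoning
      to : ∀ {t} → vert (dart (v , t)) ≡ v × vert (pair (dart (v , t))) ∈ S → proj₁ (link (v , t)) ∈ S
      to (_ , into) = subst (_∈ S) (vert-pair-dart _) into
      from : ∀ {t} → proj₁ (link (v , t)) ∈ S → vert (dart (v , t)) ≡ v × vert (pair (dart (v , t))) ∈ S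
      from into = vert-dart _ , subst (_∈ S) (sym (vert-pair-dart _)) into

  module _ (μ : Fin n → Fin d) where

    OnSlot : Fin n × Fin d → Set
    OnSlot (v , t) = t ≡ μ v

    onSlot? : ∀ p → Dec (OnSlot p)
    onSlot? (v , t) = t ≟ μ v

    chosen : Fin (n * d) → Bool
    chosen x = does (onSlot? (remQuot d x))

    private
      chosen-dart : ∀ p → chosen (dart p) ≡ does (onSlot? p)
      chosen-dart p = cong (does ∘ onSlot?) (remQuot-dart p)

      chosen⇒onSlot : ∀ p → chosen (dart p) ≡ true → OnSlot p
      chosen⇒onSlot p eq with onSlot? p | chosen-dart p
      ... | yes on | _ = on
      ... | no _   | eq′ = contradiction (trans (sym eq′) eq) λ ()

    chosen-oneFactor : (∀ p → OnSlot p → OnSlot (link p)) → IsOneFactor graph chosen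
    chosen-oneFactor closed = pair-closed , one-per-vertex
      where
        reflected : ∀ p → OnSlot (link p) → OnSlot p
        reflected p on = subst OnSlot (link-involutive p) (closed (link p) on)
        pair-closed : ∀ x → chosen (pair x) ≡ chosen x
        pair-closed = ∀-dart λ p → begin
          chosen (pair (dart p))   ≡⟨ cong chosen (pair-dart p) ⟩
          chosen (dart (link p))   ≡⟨ chosen-dart (link p) ⟩
          does (onSlot? (link p))  ≡⟨ does-⇔ (mk⇔ (reflected p) (closed p)) (onSlot? (link p)) (onSlot? p) ⟩
          does (onSlot? p)         ≡⟨ chosen-dart p ⟨
          chosen (dart p)          ∎
          where open ≡-Reasoning
        one-per-vertex : ∀ v → count (λ x → (vert x ≟ v) ×-dec (chosen x Data.Bool.≟ true)) ≡ 1
        one-per-vertex v = count-unique _ {dart (v , μ v)}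
          (vert-dart (v , μ v) , trans (chosen-dart (v , μ v)) (dec-true (onSlot? (v , μ v)) refl))
          (∀-dart λ p (at , ch) → only p at ch)
          where
            only : ∀ p → vert (dart p) ≡ v → chosen (dart p) ≡ true → dart p ≡ dart (v , μ v)
            only (u , t) at ch with trans (sym (vert-dart (u , t))) at
            ... | refl = cong (dart ∘ (u ,_)) (chosen⇒onSlot (u , t) ch)

    semi⇒chosen : (∀ p → link p ≡ p → OnSlot p) → ∀ x → IsSemi graph x → chosen x ≡ true
    semi⇒chosen fixed⇒on = ∀-dart λ p semi → trans (chosen-dart p)
      (dec-true (onSlot? p) (fixed⇒on p (dart-injective (trans (sym (pair-dart p)) semi))))

data Halving : ℕ → Set where
  even : ∀ h → Halving (h + h)
  odd  : ∀ h → Halving (suc (h + h))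

halving : ∀ n → Halving n
halving zero = even zero
halving (suc n) with halving n
... | even h = odd h
... | odd h  = subst Halving (cong suc (+-suc h h)) (even (suc h))

2∣n+n : ∀ n → 2 ∣ n + n
2∣n+n n = divides n (trans (cong (n +_) (sym (+-identityʳ n))) (*-comm 2 n))

¬2∣⇒odd : ∀ {n} → ¬ 2 ∣ n → ∃ λ c → n ≡ suc (c + c)
¬2∣⇒odd {n} 2∤n with halving n
... | even h = contradiction (2∣n+n h) 2∤n
... | odd h  = h , refl

2∣suc⇒¬2∣ : ∀ {n} → 2 ∣ suc n → ¬ 2 ∣ n
2∣suc⇒¬2∣ {n} 2∣1+n 2∣n =
  contradiction (∣1⇒≡1 (∣m+n∣m⇒∣n (subst (2 ∣_) (+-comm 1 n) 2∣1+n) 2∣n)) λ ()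

m+m≤n+n⇒m≤n : ∀ {m n} → m + m ≤ n + n → m ≤ n
m+m≤n+n⇒m≤n {m} {n} m+m≤n+n with m ≤? n
... | yes m≤n = m≤n
... | no m≰n  = contradiction m+m≤n+n (<⇒≱ (+-mono-< (≰⇒> m≰n) (≰⇒> m≰n)))

m+m≡n+n⇒m≡n : ∀ {m n} → m + m ≡ n + n → m ≡ n
m+m≡n+n⇒m≡n eq = ≤-antisym (m+m≤n+n⇒m≤n (≤-reflexive eq)) (m+m≤n+n⇒m≤n (≤-reflexive (sym eq)))

m+m<n+n⇒m<n : ∀ {m n} → m + m < n + n → m < n
m+m<n+n⇒m<n {m} {n} m+m<n+n with m <? n
... | yes m<n = m<n
... | no m≮n  = contradiction m+m<n+n (≤⇒≯ (+-mono-≤ (≮⇒≥ m≮n) (≮⇒≥ m≮n)))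

module _ {q : ℕ} where

  data AddsTo (i j k : Fin q) : Set where
    exact : toℕ i + toℕ j ≡ toℕ k     → AddsTo i j k
    wraps : toℕ i + toℕ j ≡ toℕ k + q → AddsTo i j k

  private
    wrapped≮q : ∀ {m n} → m ≡ n + q → ¬ m < q
    wrapped≮q {n = n} m≡n+q m<q = <⇒≱ m<q (subst (q ≤_) (sym m≡n+q) (m≤n+m q n))

    cancel-wrap : ∀ {x y y′ z} → x + y ≡ z → x + y′ ≡ z + q → y′ ≡ y + q
    cancel-wrap {x} {y} {y′} {z} x+y≡z x+y′≡z+q = +-cancelˡ-≡ x y′ (y + q) (begin
      x + y′       ≡⟨ x+y′≡z+q ⟩
      z + q        ≡⟨ cong (_+ q) x+y≡z ⟨
      x + y + q    ≡⟨ +-assoc x y q ⟩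
      x + (y + q)  ∎)
      where open ≡-Reasoning

  addsTo-comm : ∀ {i j k} → AddsTo i j k → AddsTo j i k
  addsTo-comm {i} {j} (exact e) = exact (trans (+-comm (toℕ j) (toℕ i)) e)
  addsTo-comm {i} {j} (wraps e) = wraps (trans (+-comm (toℕ j) (toℕ i)) e)

  addsTo-cancelˡ : ∀ {i j j′ k} → AddsTo i j k → AddsTo i j′ k → j ≡ j′
  addsTo-cancelˡ {i} (exact e) (exact e′) = toℕ-injective (+-cancelˡ-≡ (toℕ i) _ _ (trans e (sym e′)))
  addsTo-cancelˡ {i} (wraps e) (wraps e′) = toℕ-injective (+-cancelˡ-≡ (toℕ i) _ _ (trans e (sym e′)))
  addsTo-cancelˡ {j′ = j′} (exact e) (wraps e′) = contradiction (toℕ<n j′) (wrapped≮q (cancel-wrap e e′))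
  addsTo-cancelˡ {j = j}   (wraps e) (exact e′) = contradiction (toℕ<n j) (wrapped≮q (cancel-wrap e′ e))

  addsTo-functional : ∀ {i j k k′} → AddsTo i j k → AddsTo i j k′ → k ≡ k′
  addsTo-functional (exact e) (exact e′) = toℕ-injective (trans (sym e) e′)
  addsTo-functional (wraps e) (wraps e′) = toℕ-injective (+-cancelʳ-≡ q _ _ (trans (sym e) e′))
  addsTo-functional {k = k}  (exact e) (wraps e′) = contradiction (toℕ<n k) (wrapped≮q (trans (sym e) e′))
  addsTo-functional {k′ = k′} (wraps e) (exact e′) = contradiction (toℕ<n k′) (wrapped≮q (trans (sym e′) e))

  addsTo-sum : ∀ i j → ∃ λ k → AddsTo i j k
  addsTo-sum i j with toℕ i + toℕ j <? q
  ... | yes s<q = fromℕ< s<q , exact (sym (toℕ-fromℕ< s<q))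
  ... | no s≮q  =
    fromℕ< r<q , wraps (sym (trans (cong (_+ q) (toℕ-fromℕ< r<q)) (m∸n+n≡m q≤s)))
    where
      q≤s = ≮⇒≥ s≮q
      r<q : toℕ i + toℕ j ∸ q < q
      r<q = +-cancelʳ-< q _ q (subst (_< q + q) (sym (m∸n+n≡m q≤s)) (+-mono-< (toℕ<n i) (toℕ<n j)))

  addsTo-difference : ∀ i k → ∃ λ j → AddsTo i j k
  addsTo-difference i k with toℕ i ≤? toℕ k
  ... | yes i≤k = fromℕ< j<q , exact (trans (cong (toℕ i +_) (toℕ-fromℕ< j<q)) (m+[n∸m]≡n i≤k))
    where j<q = ≤-<-trans (m∸n≤m (toℕ k) (toℕ i)) (toℕ<n k)
  ... | no i≰k  = fromℕ< j<q , wraps (trans (cong (toℕ i +_) (toℕ-fromℕ< j<q)) (m+[n∸m]≡n i≤k+q))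
    where
      i≤k+q = ≤-trans (<⇒≤ (toℕ<n i)) (m≤n+m q (toℕ k))
      j<q : toℕ k + q ∸ toℕ i < q
      j<q = +-cancelˡ-< (toℕ i) _ q
              (subst (_< toℕ i + q) (sym (m+[n∸m]≡n i≤k+q)) (+-monoˡ-< q (≰⇒> i≰k)))

  double : Fin q → Fin q
  double i = proj₁ (addsTo-sum i i)

  reflect : Fin q → Fin q → Fin q
  reflect k i = proj₁ (addsTo-difference i k)

  reflect-involutive : ∀ k i → reflect k (reflect k i) ≡ i
  reflect-involutive k i =
    addsTo-cancelˡ (proj₂ (addsTo-difference (reflect k i) k))
                   (addsTo-comm (proj₂ (addsTo-difference i k)))

  reflect-injective : ∀ {k k′} i → reflect k i ≡ reflect k′ i → k ≡ k′
  reflect-injective {k} {k′} i eq = addsTo-functional (proj₂ (addsTo-difference i k))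
    (subst (λ j → AddsTo i j k′) (sym eq) (proj₂ (addsTo-difference i k′)))

  reflect-fixed : ∀ k i → reflect k i ≡ i ⇔ double i ≡ k
  reflect-fixed k i = mk⇔
    (λ fixed → addsTo-functional (proj₂ (addsTo-sum i i))
                 (subst (λ j → AddsTo i j k) fixed (proj₂ (addsTo-difference i k))))
    (λ doubled → addsTo-cancelˡ (proj₂ (addsTo-difference i k))
                   (subst (AddsTo i i) doubled (proj₂ (addsTo-sum i i))))

  module _ (q-odd : ¬ 2 ∣ q) where

    private
      c = proj₁ (¬2∣⇒odd q-odd)
      q≡ = proj₂ (¬2∣⇒odd q-odd)

      half : ∀ {n} → n < q → ∃ λ h → h < q × (h + h ≡ n ⊎ h + h ≡ n + q)
      half {n} n<q with halving n
      ... | even h = h , ≤-<-trans (m≤m+n h h) n<q , inj₁ refl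
      -- (n + q) / 2 = h + c + 1 for n = 2h + 1 and q = 2c + 1
      ... | odd h  = h + suc c , h+1+c<q , inj₂ (trans (lemma h c) (cong (suc (h + h) +_) (sym q≡)))
        where
          h<c : h < c
          h<c = m+m<n+n⇒m<n (s<s⁻¹ (subst (suc (h + h) <_) q≡ n<q))
          h+1+c<q : h + suc c < q
          h+1+c<q = subst₂ _<_ (sym (+-suc h c)) (sym q≡) (s<s (+-monoˡ-< c h<c))
          lemma : ∀ h c → h + suc c + (h + suc c) ≡ suc (h + h) + suc (c + c)
          lemma = solve-∀

    addsTo-half : ∀ k → ∃ λ i → AddsTo i i k
    addsTo-half k with h , h<q , sum ← half (toℕ<n k) =
      fromℕ< h<q , [ exact ∘ trans h+h , wraps ∘ trans h+h ]′ sum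
      where h+h = cong₂ _+_ (toℕ-fromℕ< h<q) (toℕ-fromℕ< h<q)

    addsTo-half-unique : ∀ {i j k} → AddsTo i i k → AddsTo j j k → i ≡ j
    addsTo-half-unique (exact e) (exact e′) = toℕ-injective (m+m≡n+n⇒m≡n (trans e (sym e′)))
    addsTo-half-unique (wraps e) (wraps e′) = toℕ-injective (m+m≡n+n⇒m≡n (trans e (sym e′)))
    -- otherwise i + i and j + j would differ by the odd number q
    addsTo-half-unique {i} {j} (exact e) (wraps e′) = ⊥-elim (q-odd (∣m+n∣m⇒∣n
      (subst (2 ∣_) (trans e′ (cong (_+ q) (sym e))) (2∣n+n (toℕ j))) (2∣n+n (toℕ i))))
    addsTo-half-unique {i} {j} (wraps e) (exact e′) = ⊥-elim (q-odd (∣m+n∣m⇒∣n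
      (subst (2 ∣_) (trans e (cong (_+ q) (sym e′))) (2∣n+n (toℕ i))) (2∣n+n (toℕ j))))

    halve : Fin q → Fin q
    halve k = proj₁ (addsTo-half k)

    double-halve : ∀ k → double (halve k) ≡ k
    double-halve k = addsTo-functional (proj₂ (addsTo-sum (halve k) (halve k))) (proj₂ (addsTo-half k))

    halve-double : ∀ i → halve (double i) ≡ i
    halve-double i = addsTo-half-unique (proj₂ (addsTo-half (double i))) (proj₂ (addsTo-sum i i))

    doubling : Permutation′ q
    doubling = permutation double halve double-halve halve-double

-- A fixed point of mate c is a semi-edge of colour c.
record OneFactorisation (n m : ℕ) : Set where
  field
    mate            : Fin m → Fin n → Fin n
    mate-involutive : ∀ c v → mate c (mate c v) ≡ v
    mate-injective  : ∀ {c c′} v → mate c v ≡ mate c′ v → c ≡ c′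

restrict : ∀ {n m k} (f : Fin m → Fin k) → (∀ {c c′} → f c ≡ f c′ → c ≡ c′) →
           OneFactorisation n k → OneFactorisation n m
restrict f f-injective F = record
  { mate            = mate ∘ f
  ; mate-involutive = mate-involutive ∘ f
  ; mate-injective  = λ v → f-injective ∘ mate-injective v
  }
  where open OneFactorisation F

reflections : ∀ q → OneFactorisation q q
reflections q = record
  { mate            = reflect
  ; mate-involutive = reflect-involutive
  ; mate-injective  = reflect-injective
  }

module _ {q} (q-odd : ¬ 2 ∣ q) where

  private
    centre = halve q-odd

    fixed⇔centre : ∀ k i → reflect k i ≡ i ⇔ i ≡ centre k
    fixed⇔centre k i = mk⇔
      (λ fixed → trans (sym (halve-double q-odd i))
                       (cong centre (Equivalence.to (reflect-fixed k i) fixed)))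
      (λ { refl → Equivalence.from (reflect-fixed k i) (double-halve q-odd k) })

    centre-injective : ∀ {k k′} → centre k ≡ centre k′ → k ≡ k′
    centre-injective {k} {k′} eq =
      trans (sym (double-halve q-odd k)) (trans (cong double eq) (double-halve q-odd k′))

  -- zero plays the vertex ∞, matched with the fixed point of reflect k
  reflect∞ : Fin q → Fin (suc q) → Fin (suc q)
  reflect∞ k zero = suc (centre k)
  reflect∞ k (suc i) with i ≟ centre k
  ... | yes _ = zero
  ... | no _  = suc (reflect k i)

  private
    reflect∞-centre : ∀ k → reflect∞ k (suc (centre k)) ≡ zero
    reflect∞-centre k with centre k ≟ centre k
    ... | yes _ = refl
    ... | no ≢ = contradiction refl ≢

    reflect∞-off : ∀ {k i} → i ≢ centre k → reflect∞ k (suc i) ≡ suc (reflect k i)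
    reflect∞-off {k} {i} i≢c with i ≟ centre k
    ... | yes i≡c = contradiction i≡c i≢c
    ... | no _    = refl

  reflect∞-involutive : ∀ k v → reflect∞ k (reflect∞ k v) ≡ v
  reflect∞-involutive k zero = reflect∞-centre k
  reflect∞-involutive k (suc i) with i ≟ centre k
  ... | yes refl = refl
  ... | no i≢c   = trans (reflect∞-off (i≢c ∘ moved)) (cong suc (reflect-involutive k i))
    where
      moved : reflect k i ≡ centre k → i ≡ centre k
      moved eq = trans (sym (reflect-involutive k i))
                       (trans (cong (reflect k) eq) (Equivalence.from (fixed⇔centre k (centre k)) refl))

  reflect∞-injective : ∀ {k k′} v → reflect∞ k v ≡ reflect∞ k′ v → k ≡ k′
  reflect∞-injective zero eq = centre-injective (suc-injective eq)
  reflect∞-injective {k} {k′} (suc i) eq with i ≟ centre k | i ≟ centre k′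
  ... | yes i≡c | yes i≡c′ = centre-injective (trans (sym i≡c) i≡c′)
  ... | yes _   | no _     = contradiction eq 0≢1+n
  ... | no _    | yes _    = contradiction (sym eq) 0≢1+n
  ... | no _    | no _     = reflect-injective i (suc-injective eq)

  reflect∞-moves : ∀ k v → reflect∞ k v ≢ v
  reflect∞-moves k zero ()
  reflect∞-moves k (suc i) with i ≟ centre k
  ... | yes _ = λ ()
  ... | no i≢c = i≢c ∘ Equivalence.to (fixed⇔centre k i) ∘ suc-injective

  reflections∞ : OneFactorisation (suc q) q
  reflections∞ = record
    { mate            = reflect∞
    ; mate-involutive = reflect∞-involutive
    ; mate-injective  = reflect∞-injective
    }

data Split (m n : ℕ) : Fin (m + n) → Set where
  inl : ∀ i → Split m n (i ↑ˡ n)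
  inr : ∀ j → Split m n (m ↑ʳ j)

split : ∀ m {n} i → Split m n i
split zero    j       = inr j
split (suc m) zero    = inl zero
split (suc m) (suc i) with split m i
... | inl j = inl (suc j)
... | inr j = inr j

↑ˡ≢↑ʳ : ∀ {m n} {i : Fin m} {j : Fin n} → i ↑ˡ n ≢ m ↑ʳ j
↑ˡ≢↑ʳ {m} {n} {i} {j} eq with trans (sym (splitAt-↑ˡ m i n)) (trans (cong (splitAt m) eq) (splitAt-↑ʳ m n j))
... | ()

module CoverGraph {r m : ℕ} (F : OneFactorisation (r + m) m) where
  open OneFactorisation F

  private
    d = r + m

  -- The vertices a ↑ˡ r form A and d ↑ʳ s form S.  At a ∈ A slot s ↑ˡ m is the edge to
  -- s ∈ S and slot r ↑ʳ c the edge of colour c; at s ∈ S slot a is the edge to a.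
  link : Fin (d + r) × Fin d → Fin (d + r) × Fin d
  link (v , t) = [ fromA , fromS ]′ (splitAt d v)
    where
      fromS : Fin r → Fin (d + r) × Fin d
      fromS s = t ↑ˡ r , s ↑ˡ m
      fromA : Fin d → Fin (d + r) × Fin d
      fromA a = [ (λ s → d ↑ʳ s , a) , (λ c → mate c a ↑ˡ r , r ↑ʳ c) ]′ (splitAt r t)

  link-↑ˡ-↑ˡ : ∀ a s → link (a ↑ˡ r , s ↑ˡ m) ≡ (d ↑ʳ s , a)
  link-↑ˡ-↑ˡ a s rewrite splitAt-↑ˡ d a r | splitAt-↑ˡ r s m = refl

  link-↑ˡ-↑ʳ : ∀ a c → link (a ↑ˡ r , r ↑ʳ c) ≡ (mate c a ↑ˡ r , r ↑ʳ c)
  link-↑ˡ-↑ʳ a c rewrite splitAt-↑ˡ d a r | splitAt-↑ʳ r m c = refl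

  link-↑ʳ : ∀ s a → link (d ↑ʳ s , a) ≡ (a ↑ˡ r , s ↑ˡ m)
  link-↑ʳ s a rewrite splitAt-↑ʳ d r s = refl

  link-involutive : ∀ p → link (link p) ≡ p
  link-involutive (v , t) with split d v
  ... | inr s rewrite link-↑ʳ s t | link-↑ˡ-↑ˡ t s = refl
  ... | inl a with split r t
  ...   | inl s rewrite link-↑ˡ-↑ˡ a s | link-↑ʳ s a = refl
  ...   | inr c rewrite link-↑ˡ-↑ʳ a c | link-↑ˡ-↑ʳ (mate c a) c | mate-involutive c a = refl

  link-stays : ∀ p → proj₁ (link p) ≡ proj₁ p → ∃₂ λ a c → p ≡ (a ↑ˡ r , r ↑ʳ c) × mate c a ≡ a
  link-stays (v , t) stays with split d v
  ... | inr s = contradiction (trans (sym (cong proj₁ (link-↑ʳ s t))) stays) ↑ˡ≢↑ʳ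
  ... | inl a with split r t
  ...   | inl s = contradiction (trans (sym stays) (cong proj₁ (link-↑ˡ-↑ˡ a s))) ↑ˡ≢↑ʳ
  ...   | inr c = a , c , refl , ↑ˡ-injective r _ _ (trans (sym (cong proj₁ (link-↑ˡ-↑ʳ a c))) stays)

  link-injective : ∀ v {t t′} → proj₁ (link (v , t)) ≡ proj₁ (link (v , t′)) → t ≡ t′
  link-injective v {t} {t′} with split d v
  ... | inr s rewrite link-↑ʳ s t | link-↑ʳ s t′ = ↑ˡ-injective r t t′
  ... | inl a with split r t | split r t′
  ...   | inl s | inl s′ rewrite link-↑ˡ-↑ˡ a s | link-↑ˡ-↑ˡ a s′ = cong (_↑ˡ m) ∘ ↑ʳ-injective d s s′
  ...   | inl s | inr c′ rewrite link-↑ˡ-↑ˡ a s | link-↑ˡ-↑ʳ a c′ = λ eq → contradiction (sym eq) ↑ˡ≢↑ʳ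
  ...   | inr c | inl s′ rewrite link-↑ˡ-↑ʳ a c | link-↑ˡ-↑ˡ a s′ = λ eq → contradiction eq ↑ˡ≢↑ʳ
  ...   | inr c | inr c′ rewrite link-↑ˡ-↑ʳ a c | link-↑ˡ-↑ʳ a c′ =
    cong (r ↑ʳ_) ∘ mate-injective a ∘ ↑ˡ-injective r _ _

  module Slots = SlotGraph link link-involutive
  open Slots public using (graph; regular)
  open Slots using (OnSlot; chosen)

  noLoops : NoLoops graph
  noLoops = Slots.noLoops stays
    where
      stays : ∀ p → proj₁ (link p) ≡ proj₁ p → link p ≡ p
      stays p same with link-stays p same
      ... | a , c , refl , fixed = trans (link-↑ˡ-↑ʳ a c) (cong (λ b → b ↑ˡ r , r ↑ʳ c) fixed)

  noMultipleEdges : NoMultipleEdges graph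
  noMultipleEdges = Slots.noMultipleEdges link-injective

  simple : (∀ c a → mate c a ≢ a) → Simple graph
  simple moves = noLoops , noMultipleEdges , Slots.noSemiEdges fixed-free
    where
      fixed-free : ∀ p → link p ≢ p
      fixed-free p fixed with link-stays p (cong proj₁ fixed)
      ... | a , c , refl , mate-fixed = moves c a mate-fixed

  S : Subset (d + r)
  S = ⊥ {d} ++ ⊤ {r}

  ↑ˡ∉S : ∀ a → a ↑ˡ r ∉ S
  ↑ˡ∉S a a∈S = ∉⊥ (lookup⇒[]= a ⊥ (trans (sym (lookup-++ˡ ⊥ (⊤ {r}) a)) ([]=⇒lookup a∈S)))

  ↑ʳ∈S : ∀ s → d ↑ʳ s ∈ S
  ↑ʳ∈S s = lookup⇒[]= (d ↑ʳ s) S (trans (lookup-++ʳ (⊥ {d}) ⊤ s) ([]=⇒lookup (∈⊤ {x = s})))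

  independent : Independent graph S
  independent = outward⇒independent graph (Slots.outward out)
    where
      out : ∀ p → proj₁ p ∈ S → proj₁ (link p) ∉ S
      out (v , t) v∈S with split d v
      ... | inl a = contradiction v∈S (↑ˡ∉S a)
      ... | inr s = subst (_∉ S) (sym (cong proj₁ (link-↑ʳ s t))) (↑ˡ∉S t)

  exactCover : ExactCover graph r S
  exactCover v v∉S with split d v
  ... | inr s = contradiction (↑ʳ∈S s) v∉S
  ... | inl a = begin
    edgesInto graph S (a ↑ˡ r)                            ≡⟨ Slots.edgesInto-slots v∉S ⟩
    count (λ t → proj₁ (link (a ↑ˡ r , t)) ∈? S)          ≡⟨ count-+ r _ ⟩
    count (λ s → proj₁ (link (a ↑ˡ r , s ↑ˡ m)) ∈? S)
      + count (λ c → proj₁ (link (a ↑ˡ r , r ↑ʳ c)) ∈? S) ≡⟨ cong₂ _+_ (count-all _ toS) (count-none _ toA) ⟩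
    r + 0                                                 ≡⟨ +-identityʳ r ⟩
    r                                                     ∎
    where
      open ≡-Reasoning
      toS : ∀ s → proj₁ (link (a ↑ˡ r , s ↑ˡ m)) ∈ S
      toS s = subst (_∈ S) (sym (cong proj₁ (link-↑ˡ-↑ˡ a s))) (↑ʳ∈S s)
      toA : ∀ c → proj₁ (link (a ↑ˡ r , r ↑ʳ c)) ∉ S
      toA c = subst (_∉ S) (sym (cong proj₁ (link-↑ˡ-↑ʳ a c))) (↑ˡ∉S (mate c a))

  module _ (φ : Permutation′ d) (fixed⇔φ : ∀ c a → mate c a ≡ a ⇔ φ ⟨$⟩ʳ a ≡ r ↑ʳ c) where

    matchSlot : Fin (d + r) → Fin d
    matchSlot v = [ φ ⟨$⟩ʳ_ , (λ s → φ ⟨$⟩ˡ (s ↑ˡ m)) ]′ (splitAt d v)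

    matchSlot-↑ˡ : ∀ a → matchSlot (a ↑ˡ r) ≡ φ ⟨$⟩ʳ a
    matchSlot-↑ˡ a rewrite splitAt-↑ˡ d a r = refl

    matchSlot-↑ʳ : ∀ s → matchSlot (d ↑ʳ s) ≡ φ ⟨$⟩ˡ (s ↑ˡ m)
    matchSlot-↑ʳ s rewrite splitAt-↑ʳ d r s = refl

    matchSlot-closed : ∀ p → OnSlot matchSlot p → OnSlot matchSlot (link p)
    matchSlot-closed (v , t) on with split d v
    ... | inr s rewrite link-↑ʳ s t = begin
      s ↑ˡ m                          ≡⟨ inverseʳ φ ⟨
      φ ⟨$⟩ʳ (φ ⟨$⟩ˡ (s ↑ˡ m))        ≡⟨ cong (φ ⟨$⟩ʳ_) (trans (sym (matchSlot-↑ʳ s)) (sym on)) ⟩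
      φ ⟨$⟩ʳ t                        ≡⟨ matchSlot-↑ˡ t ⟨
      matchSlot (t ↑ˡ r)              ∎
      where open ≡-Reasoning
    ... | inl a with split r t
    ...   | inl s rewrite link-↑ˡ-↑ˡ a s = begin
      a                               ≡⟨ inverseˡ φ ⟨
      φ ⟨$⟩ˡ (φ ⟨$⟩ʳ a)               ≡⟨ cong (φ ⟨$⟩ˡ_) (trans (sym (matchSlot-↑ˡ a)) (sym on)) ⟩
      φ ⟨$⟩ˡ (s ↑ˡ m)                 ≡⟨ matchSlot-↑ʳ s ⟨
      matchSlot (d ↑ʳ s)              ∎
      where open ≡-Reasoning
    ...   | inr c rewrite link-↑ˡ-↑ʳ a c = begin
      r ↑ʳ c                          ≡⟨ trans on (matchSlot-↑ˡ a) ⟩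
      φ ⟨$⟩ʳ a                        ≡⟨ cong (φ ⟨$⟩ʳ_) fixed ⟨
      φ ⟨$⟩ʳ mate c a                 ≡⟨ matchSlot-↑ˡ (mate c a) ⟨
      matchSlot (mate c a ↑ˡ r)       ∎
      where
        open ≡-Reasoning
        fixed = Equivalence.from (fixed⇔φ c a) (sym (trans on (matchSlot-↑ˡ a)))

    matchSlot-semi : ∀ p → link p ≡ p → OnSlot matchSlot p
    matchSlot-semi p fixed with link-stays p (cong proj₁ fixed)
    ... | a , c , refl , mate-fixed =
      sym (trans (matchSlot-↑ˡ a) (Equivalence.to (fixed⇔φ c a) mate-fixed))

    oneFactor⊇semiEdges : Σ (Fin (GenGraph.nD graph) → Bool) λ M →
                            IsOneFactor graph M × (∀ x → IsSemi graph x → M x ≡ true)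
    oneFactor⊇semiEdges = chosen matchSlot
                        , Slots.chosen-oneFactor matchSlot matchSlot-closed
                        , Slots.semi⇒chosen matchSlot matchSlot-semi

lemma3p1 : (d r : ℕ) → 1 ≤ d → 1 ≤ r → r ≤ d →
    Σ GenGraph λ G →
      GenGraph.nV G ≡ d + r
      × Regular G d
      × NoLoops G
      × NoMultipleEdges G
      × Σ (Subset (GenGraph.nV G)) (IndependentExactCover G r)
      × (2 ∣ d → Simple G)
      × (¬ (2 ∣ d) → Σ (Fin (GenGraph.nD G) → Bool) λ M →
           IsOneFactor G M × (∀ x → IsSemi G x → M x ≡ true))
lemma3p1 d zero _ () _
lemma3p1 d r@(suc r′) _ _ r≤d with m≤n⇒∃[o]m+o≡n r≤d
... | m , refl with 2 ∣? r + m
...   | yes 2∣d = graph , refl , regular , noLoops , noMultipleEdges , (S , independent , exactCover)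
                , (λ _ → simple (reflect∞-moves q-odd ∘ (r′ ↑ʳ_))) , (λ 2∤d → contradiction 2∣d 2∤d)
  where
    q-odd = 2∣suc⇒¬2∣ 2∣d
    open CoverGraph {r} (restrict (r′ ↑ʳ_) (↑ʳ-injective r′ _ _) (reflections∞ q-odd))
...   | no 2∤d = graph , refl , regular , noLoops , noMultipleEdges , (S , independent , exactCover)
               , (λ 2∣d → contradiction 2∣d 2∤d)
               , (λ _ → oneFactor⊇semiEdges (doubling 2∤d) (λ c → reflect-fixed (r ↑ʳ c)))
  where open CoverGraph {r} (restrict (r ↑ʳ_) (↑ʳ-injective r _ _) (reflections (r + m)))
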